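{- Let $(G_x,\mathrm{lab}_x)=\rho_{i\to\emptyset}(G_y,\mathrm{lab}_y)$ for some label $i\in[k]$, and let $\mathcal{A}_y\subseteq\mathrm{aux}(G_y,\mathrm{lab}_y)$ satisfy $\mathcal{A}_y\lesssim\mathrm{aux}(G_y,\mathrm{lab}_y)$. Define $\mathcal{A}_x=\{A\in\mathcal{A}_y : \deg_A(i)=0\}$. Then $\mathcal{A}_x\subseteq\mathrm{aux}(G_x,\mathrm{lab}_x)$ and $\mathcal{A}_x\lesssim\mathrm{aux}(G_x,\mathrm{lab}_x)$.
   Context: A multi-$k$-labeled graph is $(H,\mathrm{lab})$ with $\mathrm{lab}:V(H)\to2^{[k]}$. The relabel operation $\rho_{i\to\emptyset}$ keeps the graph and removes label $i$ from every label set. A path packing of $H$ is a set of vertex-disjoint paths (possibly of length 0) in $H$ covering all vertices of $H$. A label choice of a path packing $\mathcal{P}$ is a map $\phi:\mathcal{P}\to\binom{[k]}{1}\cup\binom{[k]}{2}$ such that for each path $P$ with endpoints $u,v$ ($u=v$ iff $P$ has length 0), writing $\phi(P)=\{a,b\}$ (possibly $a=b$), we have $a\in\mathrm{lab}(u),b\in\mathrm{lab}(v)$ or $a\in\mathrm{lab}(v),b\in\mathrm{lab}(u)$. Multigraphs here have vertex set $[k]$, may have loops and parallel edges, each edge carrying an identifier; two multigraphs are equal if every pair $\{a,b\}$ (including $a=b$) has the same multiplicity; a loop contributes 2 to the degree. The auxiliary multigraph $\mathrm{aux}(\mathcal{P},\phi)$ has, for all $a,b\in[k]$, multiplicity of $\{a,b\}$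 equal to $|\phi^{ -1}(\{a,b\})|$; its edges are colored red. $\mathrm{aux}(H,\mathrm{lab})$ is the set of $\mathrm{aux}(\mathcal{P},\phi)$ over all path packings $\mathcal{P}$ of $H$ and label choices $\phi$. $A\uplus B$ is the multigraph whose multiplicities are the sums. For a multigraph with red and blue edges and at least one edge, a red-blue Eulerian trail is a closed walk traversing every edge exactly once in which colors alternate (in particular the first and last edges have different colors). For families $\mathcal{A},\mathcal{B}$ of red multigraphs, $\mathcal{A}\lesssim\mathcal{B}$ means: for every multigraph $M$ on $[k]$ with blue edges, if some $B\in\mathcal{B}$ makes $B\uplus M$ admit a red-blue Eulerian trail, then some $A\in\mathcal{A}$ makes $A\uplus M$ admit a red-blue Eulerian trail. -}

module Defs where

open import Data.Nat using (ℕ; zero; suc; _+_)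
open import Data.Bool using (Bool; true; false; if_then_else_)
open import Data.Fin using (Fin)
open import Data.Fin.Properties using () renaming (_≟_ to _≟F_)
open import Data.Fin.Subset using (Subset; _∈_; _─_; ⁅_⁆)
open import Data.List using (List; []; _∷_; _++_; map; length; allFin; concatMap; tabulate; zip)
open import Data.Nat.ListAction using (sum)
open import Data.List.Relation.Unary.Linked using (Linked)
open import Data.List.Relation.Unary.All using (All)
open import Data.List.Relation.Unary.Unique.Propositional using (Unique)
open import Data.List.Relation.Binary.Permutation.Propositional using (_↭_)
open import Data.List.Membership.Propositional using () renaming (_∈_ to _∈L_)
open import Data.Product using (Σ; ∃; _×_; _,_; proj₁; proj₂)
open import Data.Sum using (_⊎_)
open import Relation.Binary.PropositionalEquality using (_≡_; _≢_)
open import Relation.Nullary using (Dec; yes; no; ¬_)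

record Graph : Set where
  field
    n      : ℕ
    adj    : Fin n → Fin n → Bool
    adjSym : ∀ u v → adj u v ≡ adj v u
    loopless : ∀ v → adj v v ≡ false

record LGraph (k : ℕ) : Set where
  field
    graph : Graph
  open Graph graph public
  field
    lab : Fin n → Subset k

open LGraph public

relabel : ∀ {k} → Fin k → LGraph k → LGraph k
relabel i H = record { graph = graph H ; lab = λ v → lab H v ─ ⁅ i ⁆ }

lastV : ∀ {A : Set} → A → List A → A
lastV x []       = x
lastV _ (y ∷ ys) = lastV y ys

record Path {k} (H : LGraph k) : Set where
  field
    start    : Fin (n H)
    rest     : List (Fin (n H))
    linked   : Linked (λ u v → adj H u v ≡ true) (start ∷ rest)
    distinct : Unique (start ∷ rest)

  vertices : List (Fin (n H))
  vertices = start ∷ rest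

  end : Fin (n H)
  end = lastV start rest

open Path public

-- A path packing: paths whose vertex sets are pairwise disjoint and
-- cover V(H), i.e. the concatenated vertex lists form a permutation of V(H).
record PathPacking {k} (H : LGraph k) : Set where
  field
    paths  : List (Path H)
    covers : concatMap vertices paths ↭ allFin (n H)

open PathPacking public

ValidLabel : ∀ {k} {H : LGraph k} → Path H → Fin k × Fin k → Set
ValidLabel {H = H} P (a , b) =
  (a ∈ lab H (start P) × b ∈ lab H (end P)) ⊎
  (a ∈ lab H (end P) × b ∈ lab H (start P))

-- A label choice for a packing 𝒫: φ assigns to each path of 𝒫 (indexed
-- by its position) an unordered pair {a,b}, represented as an ordered pair.
record LabelChoice {k} {H : LGraph k} (𝒫 : PathPacking H) : Set where
  field
    φ     : Fin (length (paths 𝒫)) → Fin k × Fin k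
    valid : ∀ j → ValidLabel (Data.List.lookup (paths 𝒫) j) (φ j)

open LabelChoice public

-- Multigraphs on [k]: a list of edges (identifier = position in the list);
-- each edge is an (unordered) pair of endpoints, loops allowed.

MG : ℕ → Set
MG k = List (Fin k × Fin k)

joins? : ∀ {k} (a b : Fin k) (e : Fin k × Fin k) → Dec ((proj₁ e ≡ a × proj₂ e ≡ b) ⊎ (proj₁ e ≡ b × proj₂ e ≡ a))
joins? a b (u , v) with u ≟F a | v ≟F b | u ≟F b | v ≟F a
... | yes p | yes q | _ | _ = yes (Data.Sum.inj₁ (p , q))
... | _ | _ | yes p | yes q = yes (Data.Sum.inj₂ (p , q))
... | no p | _ | no r | _ = no λ { (Data.Sum.inj₁ (x , _)) → p x ; (Data.Sum.inj₂ (x , _)) → r x }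
... | no p | _ | yes _ | no s = no λ { (Data.Sum.inj₁ (x , _)) → p x ; (Data.Sum.inj₂ (_ , y)) → s y }
... | yes _ | no q | no r | _ = no λ { (Data.Sum.inj₁ (_ , y)) → q y ; (Data.Sum.inj₂ (x , _)) → r x }
... | yes _ | no q | yes _ | no s = no λ { (Data.Sum.inj₁ (_ , y)) → q y ; (Data.Sum.inj₂ (_ , y)) → s y }

mult : ∀ {k} → MG k → Fin k → Fin k → ℕ
mult A a b = length (Data.List.filter (joins? a b) A)

_≈MG_ : ∀ {k} → MG k → MG k → Set
A ≈MG B = ∀ a b → mult A a b ≡ mult B a b

-- degree; a loop contributes 2
deg : ∀ {k} → MG k → Fin k → ℕ
deg A i = sum (map (λ e → ind (proj₁ e) + ind (proj₂ e)) A)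
  where
  ind : _ → ℕ
  ind x with x ≟F i
  ... | yes _ = 1
  ... | no  _ = 0

auxOf : ∀ {k} {H : LGraph k} (𝒫 : PathPacking H) → LabelChoice 𝒫 → MG k
auxOf 𝒫 φc = tabulate (φ φc)

Family : ℕ → Set₁
Family k = MG k → Set

aux : ∀ {k} → LGraph k → Family k
aux H M = Σ (PathPacking H) λ 𝒫 → Σ (LabelChoice 𝒫) λ φc → M ≈MG auxOf 𝒫 φc

_⊆F_ : ∀ {k} → Family k → Family k → Set
𝒜 ⊆F ℬ = ∀ A → 𝒜 A → ℬ A

data Color : Set where
  red blue : Color

RBMG : ℕ → Set
RBMG k = List (Color × Fin k × Fin k)

_⊎RB_ : ∀ {k} → MG k → MG k → RBMG k
A ⊎RB M = map (red ,_) A ++ map (blue ,_) M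

-- a step of a walk: an edge (by identifier) and a traversal direction
Step : ∀ {k} → RBMG k → Set
Step E = Fin (length E) × Bool

module _ {k} (E : RBMG k) where
  colorOf : Step E → Color
  colorOf (j , _) = proj₁ (Data.List.lookup E j)

  src tgt : Step E → Fin k
  src (j , true)  = proj₁ (proj₂ (Data.List.lookup E j))
  src (j , false) = proj₂ (proj₂ (Data.List.lookup E j))
  tgt (j , true)  = proj₂ (proj₂ (Data.List.lookup E j))
  tgt (j , false) = proj₁ (proj₂ (Data.List.lookup E j))

  cyclicPairs : Step E → List (Step E) → List (Step E × Step E)
  cyclicPairs s ss = zip (s ∷ ss) (ss ++ (s ∷ []))

  record RBEulerianTrail : Set where
    field
      first  : Step E
      others : List (Step E)
      eachOnce : map proj₁ (first ∷ others) ↭ allFin (length E)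
      closedWalk : All (λ p → tgt (proj₁ p) ≡ src (proj₂ p)) (cyclicPairs first others)
      alternating : All (λ p → colorOf (proj₁ p) ≢ colorOf (proj₂ p)) (cyclicPairs first others)

_≲_ : ∀ {k} → Family k → Family k → Set
_≲_ {k} 𝒜 ℬ = (M : MG k) →
  (Σ (MG k) λ B → ℬ B × RBEulerianTrail (B ⊎RB M)) →
  (Σ (MG k) λ A → 𝒜 A × RBEulerianTrail (A ⊎RB M))

-- Relabelling i away does not change the graph, so a path packing of Gx is one of Gy and
-- the auxiliary multigraphs of Gx are exactly those of Gy in which i has degree 0.  The
-- inequality transfers because colours alternate along a red-blue Eulerian trail of A ⊎ M:
-- every edge at i is followed or preceded at i by an edge of the other colour, so the red
-- part A avoids i iff the blue part M does.  Hence a witness B ∈ aux Gx (avoiding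
-- i) for M makes M avoid i, and then the A ∈ 𝒜y supplied for M avoids i as well.
module Submission where

open import Defs
open import Data.Nat using (ℕ; pred)
open import Data.Fin using (Fin; zero; suc)
open import Data.Fin.Properties using () renaming (_≟_ to _≟F_)
open import Data.Fin.Subset using (Subset; _∈_; _∉_; _─_; _-_; ⁅_⁆; outside)
open import Data.Fin.Subset.Properties using (p─q⊆p; x∈p∧x≢y⇒x∈p-y; x∉⁅y⁆⇒x≢y)
open import Data.Bool using (true; false)
open import Data.Vec using (_∷_; here; there)
open import Data.List using (List; []; _∷_; _∷ʳ_; map; length; allFin; tabulate; zip; lookup; filter)
open import Data.List.Properties using (concatMap-map)
open import Data.List.Membership.Propositional using () renaming (_∈_ to _∈L_)
open import Data.List.Membership.Propositional.Properties
  using (∈-map⁺; ∈-map⁻; ∈-++⁺ˡ; ∈-++⁺ʳ; ∈-++⁻; ∈-tabulate⁺; ∈-tabulate⁻; ∈-filter⁺; ∈-filter⁻; ∈-lookup; ∈-allFin)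
open import Data.List.Relation.Binary.Permutation.Propositional using (_↭_; ↭-sym)
open import Data.List.Relation.Binary.Permutation.Propositional.Properties using (∈-resp-↭; ↭-length; ∷↭∷ʳ)
open import Data.List.Relation.Unary.Any using (here; there; index)
open import Data.List.Relation.Unary.Any.Properties using (lookup-index)
import Data.List.Relation.Unary.All as All
open import Data.Product using (∃-syntax; _×_; _,_; proj₁; proj₂)
import Data.Product as Product
open import Data.Sum using (_⊎_; inj₁; inj₂; [_,_])
import Data.Sum as Sum
open import Data.Empty using (⊥-elim)
open import Data.Unit using (⊤; tt)
open import Function using (id)
open import Relation.Nullary using (¬_; yes; no)
open import Relation.Unary using (Pred; Decidable)
open import Relation.Binary.PropositionalEquality using (_≡_; _≢_; refl; sym; trans; cong; subst)

x∈p─q⇒x∉q : ∀ {n} {x : Fin n} {p q : Subset n} → x ∈ p ─ q → x ∉ q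
x∈p─q⇒x∉q {p = _ ∷ p} {outside ∷ q} here ()
x∈p─q⇒x∉q {p = _ ∷ p} {_ ∷ q} (there x∈p─q) (there x∈q) = x∈p─q⇒x∉q {p = p} x∈p─q x∈q

x∈p-y⇒x≢y : ∀ {n} {x y : Fin n} {p : Subset n} → x ∈ p - y → x ≢ y
x∈p-y⇒x≢y {p = p} x∈p-y = x∉⁅y⁆⇒x≢y (x∈p─q⇒x∉q {p = p} x∈p-y)

∃-resp-length-filter : ∀ {a p} {A : Set a} {P : Pred A p} (P? : Decidable P) {x : A} {xs ys : List A} →
  length (filter P? xs) ≡ length (filter P? ys) → x ∈L xs → P x → ∃[ y ] y ∈L ys × P y
∃-resp-length-filter P? {xs = xs} {ys} eq x∈xs px with filter P? ys in filter-ys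
... | y ∷ _ = y , ∈-filter⁻ P? (subst (y ∈L_) (sym filter-ys) (here refl))
... | [] with filter P? xs | ∈-filter⁺ P? x∈xs px
...   | _ ∷ _ | _ with () ← eq  -- x ∈ filter P? xs makes the left length a successor

module _ {a b} {A : Set a} {B : Set b} where

  ∃-∈-zipˡ : ∀ {x : A} {xs : List A} {ys : List B} → length xs ≡ length ys →
    x ∈L xs → ∃[ y ] y ∈L ys × (x , y) ∈L zip xs ys
  ∃-∈-zipˡ {xs = _ ∷ _} {y ∷ _} _ (here refl) = y , here refl , here refl
  ∃-∈-zipˡ {xs = _ ∷ _} {_ ∷ _} eq (there x∈xs) =
    Product.map₂ (Product.map there there) (∃-∈-zipˡ (cong pred eq) x∈xs)

  ∃-∈-zipʳ : ∀ {y : B} {xs : List A} {ys : List B} → length xs ≡ length ys →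
    y ∈L ys → ∃[ x ] x ∈L xs × (x , y) ∈L zip xs ys
  ∃-∈-zipʳ {xs = x ∷ _} {_ ∷ _} _ (here refl) = x , here refl , here refl
  ∃-∈-zipʳ {xs = _ ∷ _} {_ ∷ _} eq (there y∈ys) =
    Product.map₂ (Product.map there there) (∃-∈-zipʳ (cong pred eq) y∈ys)

module _ {k : ℕ} where

  Endpoints : (Fin k → Set) → MG k → Set
  Endpoints P A = ∀ {e} → e ∈L A → P (proj₁ e) × P (proj₂ e)

  Avoids : Fin k → MG k → Set
  Avoids i = Endpoints (_≢ i)

  Touches : Fin k → Fin k × Fin k → Set
  Touches i e = proj₁ e ≡ i ⊎ proj₂ e ≡ i

  avoids⇒¬touches : ∀ {i : Fin k} {e} → proj₁ e ≢ i × proj₂ e ≢ i → ¬ Touches i e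
  avoids⇒¬touches (≢₁ , ≢₂) = [ ≢₁ , ≢₂ ]

  ¬touches⇒avoids : ∀ {i : Fin k} {e} → ¬ Touches i e → proj₁ e ≢ i × proj₂ e ≢ i
  ¬touches⇒avoids ¬touches = (λ ≡₁ → ¬touches (inj₁ ≡₁)) , (λ ≡₂ → ¬touches (inj₂ ≡₂))

  Endpoints-resp-≈MG : ∀ {P : Fin k → Set} {A B : MG k} → A ≈MG B → Endpoints P A → Endpoints P B
  Endpoints-resp-≈MG A≈B endpoints-A {a , b} e∈B
    with ∃-resp-length-filter (joins? a b) (sym (A≈B a b)) e∈B (inj₁ (refl , refl))
  ... | _ , e′∈A , inj₁ (refl , refl) = endpoints-A e′∈A
  ... | _ , e′∈A , inj₂ (refl , refl) = Product.swap (endpoints-A e′∈A)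

  deg≡0⇒Avoids : ∀ {i : Fin k} (A : MG k) → deg A i ≡ 0 → Avoids i A
  deg≡0⇒Avoids {i} ((u , v) ∷ A) deg≡0 e∈A with u ≟F i | v ≟F i
  deg≡0⇒Avoids (_ ∷ _) () _ | yes _ | _
  deg≡0⇒Avoids (_ ∷ _) () _ | no _ | yes _
  deg≡0⇒Avoids (_ ∷ _) _ (here refl) | no u≢i | no v≢i = u≢i , v≢i
  deg≡0⇒Avoids (_ ∷ A) deg≡0 (there e∈A) | no _ | no _ = deg≡0⇒Avoids A deg≡0 e∈A

  Avoids⇒deg≡0 : ∀ {i : Fin k} (A : MG k) → Avoids i A → deg A i ≡ 0
  Avoids⇒deg≡0 [] _ = refl
  Avoids⇒deg≡0 {i} ((u , v) ∷ A) avoids with u ≟F i | v ≟F i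
  ... | yes u≡i | _ = ⊥-elim (proj₁ (avoids (here refl)) u≡i)
  ... | no _ | yes v≡i = ⊥-elim (proj₂ (avoids (here refl)) v≡i)
  ... | no _ | no _ = Avoids⇒deg≡0 A (λ e∈A → avoids (there e∈A))

module _ {k} {E : RBMG k} (T : RBEulerianTrail E) where
  open RBEulerianTrail T

  private
    walk : List (Step E)
    walk = first ∷ others

    rotation : walk ↭ others ∷ʳ first
    rotation = ∷↭∷ʳ first others

  walk-successor : ∀ {s} → s ∈L walk →
    ∃[ s′ ] s′ ∈L walk × tgt E s ≡ src E s′ × colorOf E s ≢ colorOf E s′
  walk-successor s∈walk with ∃-∈-zipˡ (↭-length rotation) s∈walk
  ... | s′ , s′∈ , pair∈ =
    s′ , ∈-resp-↭ (↭-sym rotation) s′∈ , All.lookup closedWalk pair∈ , All.lookup alternating pair∈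

  walk-predecessor : ∀ {s} → s ∈L walk →
    ∃[ s′ ] s′ ∈L walk × tgt E s′ ≡ src E s × colorOf E s′ ≢ colorOf E s
  walk-predecessor s∈walk with ∃-∈-zipʳ (↭-length rotation) (∈-resp-↭ rotation s∈walk)
  ... | s′ , s′∈ , pair∈ = s′ , s′∈ , All.lookup closedWalk pair∈ , All.lookup alternating pair∈

  step-of-edge : ∀ {x} → x ∈L E → ∃[ s ] s ∈L walk × x ≡ lookup E (proj₁ s)
  step-of-edge x∈E with ∈-map⁻ proj₁ (∈-resp-↭ (↭-sym eachOnce) (∈-allFin (index x∈E)))
  ... | s , s∈walk , index≡ = s , s∈walk , trans (lookup-index x∈E) (cong (lookup E) index≡)

  module _ (i : Fin k) where

    private
      StepTouches : Step E → Set
      StepTouches s = Touches i (src E s , tgt E s)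

      edge⇒step : ∀ s → Touches i (proj₂ (lookup E (proj₁ s))) → StepTouches s
      edge⇒step (_ , true) = id
      edge⇒step (_ , false) = Sum.swap

      step⇒edge : ∀ s → StepTouches s → Touches i (proj₂ (lookup E (proj₁ s)))
      step⇒edge (_ , true) = id
      step⇒edge (_ , false) = Sum.swap

    touching-step-of-other-colour : ∀ {s} → s ∈L walk → StepTouches s →
      ∃[ s′ ] s′ ∈L walk × colorOf E s′ ≢ colorOf E s × StepTouches s′
    touching-step-of-other-colour s∈walk (inj₂ tgt≡i) with walk-successor s∈walk
    ... | s′ , s′∈ , tgt≡src , c≢ = s′ , s′∈ , (λ c≡ → c≢ (sym c≡)) , inj₁ (trans (sym tgt≡src) tgt≡i)
    touching-step-of-other-colour s∈walk (inj₁ src≡i) with walk-predecessor s∈walk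
    ... | s′ , s′∈ , tgt≡src , c≢ = s′ , s′∈ , c≢ , inj₂ (trans tgt≡src src≡i)

    touching-edge-of-other-colour : ∀ {x} → x ∈L E → Touches i (proj₂ x) →
      ∃[ y ] y ∈L E × proj₁ y ≢ proj₁ x × Touches i (proj₂ y)
    touching-edge-of-other-colour x∈E touches with step-of-edge x∈E
    ... | s , s∈walk , refl with touching-step-of-other-colour s∈walk (edge⇒step s touches)
    ... | s′ , _ , c≢ , touches′ = lookup E (proj₁ s′) , ∈-lookup (proj₁ s′) , c≢ , step⇒edge s′ touches′

module _ {k} {A M : MG k} where

  ∈-⊎RB⁻ : ∀ {x} → x ∈L A ⊎RB M → (∃[ e ] e ∈L A × x ≡ (red , e)) ⊎ (∃[ e ] e ∈L M × x ≡ (blue , e))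
  ∈-⊎RB⁻ x∈ = Sum.map (∈-map⁻ (red ,_)) (∈-map⁻ (blue ,_)) (∈-++⁻ (map (red ,_) A) x∈)

  module _ (T : RBEulerianTrail (A ⊎RB M)) (i : Fin k) where

    trail-Avoids-blue⇒red : Avoids i M → Avoids i A
    trail-Avoids-blue⇒red avoids-M {e} e∈A = ¬touches⇒avoids touches-red
      where
      touches-red : ¬ Touches i e
      touches-red touches with touching-edge-of-other-colour T i (∈-++⁺ˡ (∈-map⁺ (red ,_) e∈A)) touches
      ... | y , y∈ , y≢red , touches′ with ∈-⊎RB⁻ y∈
      ...   | inj₁ (_ , _ , refl) = y≢red refl
      ...   | inj₂ (_ , e′∈M , refl) = avoids⇒¬touches (avoids-M e′∈M) touches′

    trail-Avoids-red⇒blue : Avoids i A → Avoids i M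
    trail-Avoids-red⇒blue avoids-A {e} e∈M = ¬touches⇒avoids touches-blue
      where
      touches-blue : ¬ Touches i e
      touches-blue touches
        with touching-edge-of-other-colour T i (∈-++⁺ʳ (map (red ,_) A) (∈-map⁺ (blue ,_) e∈M)) touches
      ... | y , y∈ , y≢blue , touches′ with ∈-⊎RB⁻ y∈
      ...   | inj₁ (_ , e′∈A , refl) = avoids⇒¬touches (avoids-A e′∈A) touches′
      ...   | inj₂ (_ , _ , refl) = y≢blue refl

lgraph : ∀ {k} (G : Graph) → (Fin (Graph.n G) → Subset k) → LGraph k
lgraph G l = record { graph = G ; lab = l }

module _ {k} {G : Graph} {l₁ l₂ : Fin (Graph.n G) → Subset k} where

  private
    H₁ H₂ : LGraph k
    H₁ = lgraph G l₁
    H₂ = lgraph G l₂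

  relabelPath : Path H₁ → Path H₂
  relabelPath P = record { start = start P ; rest = rest P ; linked = linked P ; distinct = distinct P }

  relabelPacking : PathPacking H₁ → PathPacking H₂
  relabelPacking 𝒫 = record
    { paths  = map relabelPath (paths 𝒫)
    ; covers = subst (_↭ allFin (Graph.n G)) (sym (concatMap-map vertices relabelPath (paths 𝒫))) (covers 𝒫)
    }

  private
    unrelabelIndex : (ps : List (Path H₁)) → Fin (length (map relabelPath ps)) → Fin (length ps)
    unrelabelIndex (_ ∷ _) zero = zero
    unrelabelIndex (_ ∷ ps) (suc j) = suc (unrelabelIndex ps j)

    tabulate-unrelabelIndex : ∀ {X : Set} (ps : List (Path H₁)) (f : Fin (length ps) → X) →
      tabulate (λ j → f (unrelabelIndex ps j)) ≡ tabulate f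
    tabulate-unrelabelIndex [] f = refl
    tabulate-unrelabelIndex (_ ∷ ps) f = cong (f zero ∷_) (tabulate-unrelabelIndex ps (λ j → f (suc j)))

  module _ (C : Fin k → Set) (l₁∩C⊆l₂ : ∀ {v x} → x ∈ l₁ v → C x → x ∈ l₂ v) where

    private
      valid-relabel : ∀ ps (φ′ : Fin (length ps) → Fin k × Fin k) →
        (∀ j → ValidLabel (lookup ps j) (φ′ j)) → (∀ j → C (proj₁ (φ′ j)) × C (proj₂ (φ′ j))) →
        ∀ j → ValidLabel (lookup (map relabelPath ps) j) (φ′ (unrelabelIndex ps j))
      valid-relabel (_ ∷ _) φ′ valid′ inC zero with inC zero
      ... | Ca , Cb = Sum.map move move (valid′ zero)
        where
        move : ∀ {u v} → proj₁ (φ′ zero) ∈ l₁ u × proj₂ (φ′ zero) ∈ l₁ v →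
          proj₁ (φ′ zero) ∈ l₂ u × proj₂ (φ′ zero) ∈ l₂ v
        move = Product.map (λ a∈ → l₁∩C⊆l₂ a∈ Ca) (λ b∈ → l₁∩C⊆l₂ b∈ Cb)
      valid-relabel (_ ∷ ps) φ′ valid′ inC (suc j) =
        valid-relabel ps (λ j → φ′ (suc j)) (λ j → valid′ (suc j)) (λ j → inC (suc j)) j

    aux-relabel : ∀ {B} → aux H₁ B → Endpoints C B → aux H₂ B
    aux-relabel (𝒫 , φc , B≈aux) endpoints-B =
      relabelPacking 𝒫 ,
      record { φ = λ j → φ φc (unrelabelIndex (paths 𝒫) j)
             ; valid = valid-relabel (paths 𝒫) (φ φc) (valid φc) (λ j → endpoints-aux (∈-tabulate⁺ j)) } ,
      λ a b → trans (B≈aux a b) (cong (λ A → mult A a b) (sym (tabulate-unrelabelIndex (paths 𝒫) (φ φc))))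
      where
      endpoints-aux : Endpoints C (auxOf 𝒫 φc)
      endpoints-aux = Endpoints-resp-≈MG B≈aux endpoints-B

module _ {k} (i : Fin k) (H : LGraph k) where

  aux-relabel⁻ : ∀ {B} → aux (relabel i H) B → aux H B
  aux-relabel⁻ {B} B∈aux =
    aux-relabel (λ _ → ⊤) (λ {v} x∈ _ → p─q⊆p (lab H v) ⁅ i ⁆ x∈) {B} B∈aux (λ _ → tt , tt)

  aux-relabel⁺ : ∀ {B} → aux H B → Avoids i B → aux (relabel i H) B
  aux-relabel⁺ = aux-relabel (_≢ i) x∈p∧x≢y⇒x∈p-y

  aux-relabel-Avoids : ∀ {B} → aux (relabel i H) B → Avoids i B
  aux-relabel-Avoids (𝒫 , φc , B≈aux) =
    Endpoints-resp-≈MG (λ a b → sym (B≈aux a b)) avoids-aux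
    where
    unlabelled : ∀ {u v a b} → a ∈ lab H u - i × b ∈ lab H v - i → a ≢ i × b ≢ i
    unlabelled {u} {v} = Product.map (x∈p-y⇒x≢y {p = lab H u}) (x∈p-y⇒x≢y {p = lab H v})

    avoids-aux : Avoids i (auxOf 𝒫 φc)
    avoids-aux e∈aux with ∈-tabulate⁻ e∈aux
    ... | j , refl = [ unlabelled , unlabelled ] (valid φc j)


mainTheorem6 : ∀ {k : ℕ} (i : Fin k) (Gy : LGraph k) (𝒜y : Family k) →
    𝒜y ⊆F aux Gy → 𝒜y ≲ aux Gy →
    let Gx = relabel i Gy
        𝒜x : Family k
        𝒜x = λ A → 𝒜y A × deg A i ≡ 0
    in (𝒜x ⊆F aux Gx) × (𝒜x ≲ aux Gx)
mainTheorem6 i Gy 𝒜y 𝒜y⊆aux 𝒜y≲aux = 𝒜x⊆aux , 𝒜x≲aux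
  where
  𝒜x⊆aux : ∀ A → 𝒜y A × deg A i ≡ 0 → aux (relabel i Gy) A
  𝒜x⊆aux A (A∈𝒜y , deg≡0) = aux-relabel⁺ i Gy (𝒜y⊆aux A A∈𝒜y) (deg≡0⇒Avoids A deg≡0)

  𝒜x≲aux : (λ A → 𝒜y A × deg A i ≡ 0) ≲ aux (relabel i Gy)
  𝒜x≲aux M (B , B∈aux , T) with 𝒜y≲aux M (B , aux-relabel⁻ i Gy {B} B∈aux , T)
  ... | A , A∈𝒜y , T′ = A , (A∈𝒜y , Avoids⇒deg≡0 A avoids-A) , T′
    where
    avoids-M : Avoids i M
    avoids-M = trail-Avoids-red⇒blue T i (aux-relabel-Avoids i Gy B∈aux)

    avoids-A : Avoids i A
    avoids-A = trail-Avoids-blue⇒red T′ i avoids-M
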